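{- Let $r \ge 2$ be an integer and $\Sigma = \{a,b\}$. The partial word $w = \diamond^{r-1}\, a\, b\, a\, \diamond^{r-2}$ contains exactly two $r$th powers (as factors), both of which start at position $1$.
   Context: $\diamond$ is a hole symbol; a partial word is a finite sequence over $\Sigma \cup \{\diamond\}$, a full word one with no holes, and $\diamond^m$ denotes $m$ consecutive holes. Positions are indexed from $1$; $w[i..j]$ is the factor occupying positions $i$ to $j$, said to start at position $i$. For partial words $u, v$ of equal length, $u \subset v$ means that every non-hole position of $u$ is a non-hole position of $v$ carrying the same letter. A partial word $u$ is an $r$th power if $u \subset x^r$ for some nonempty full word $x$. -}

module Defs where

open import Data.Nat using (ℕ; suc; _∸_; _+_; _≤_)
open import Data.List using (List; []; _∷_; _++_; map; concat; replicate; take; drop; length)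
open import Data.Maybe using (Maybe; just; nothing)
open import Data.Unit using (⊤)
open import Data.Product using (∃; _×_)
open import Data.List.Relation.Binary.Pointwise using (Pointwise)
open import Relation.Binary.PropositionalEquality using (_≡_; _≢_)

data Letter : Set where
  a b : Letter

-- A partial word: a finite sequence over Σ ∪ {◇}; `nothing` is the hole ◇.
PartialWord : Set
PartialWord = List (Maybe Letter)

FullWord : Set
FullWord = List Letter

◇ : Maybe Letter
◇ = nothing

holes : ℕ → PartialWord
holes m = replicate m ◇

data _⊑_ : Maybe Letter → Maybe Letter → Set where
  hole⊑  : ∀ {y} → nothing ⊑ y
  just⊑  : ∀ {x} → just x ⊑ just x

-- u ⊂ v for partial words of equal length (Pointwise forces equal length).
_⊂_ : PartialWord → PartialWord → Set
u ⊂ v = Pointwise _⊑_ u v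

_^^_ : FullWord → ℕ → FullWord
x ^^ r = concat (replicate r x)

IsPower : ℕ → PartialWord → Set
IsPower r u = ∃ λ (x : FullWord) → (x ≢ []) × (u ⊂ map just (x ^^ r))

-- The factor of w starting at (1-indexed) position i of length ℓ,
-- i.e. w[i..i+ℓ-1].
factor : PartialWord → ℕ → ℕ → PartialWord
factor w i ℓ = take ℓ (drop (i ∸ 1) w)

ValidOcc : PartialWord → ℕ → ℕ → Set
ValidOcc w i ℓ = (1 ≤ i) × ((i ∸ 1) + ℓ ≤ length w)

wordW : ℕ → PartialWord
wordW r = holes (r ∸ 1) ++ (just a ∷ just b ∷ just a ∷ []) ++ holes (r ∸ 2)

module Submission where

-- Write r = 2 + k, so w = ◇^{k+1} a b a ◇^k has length 2r.  If a
-- factor of w is ⊂ x^r, its length is r·|x| ≤ 2r, hence |x| ∈ {1, 2}.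
--   * |x| = 2: the factor is all of w (start 1, length 2r), and w really is an
--     r-th power: it is covered by an alternating word (c ∷ flip c)^r.
--   * |x| = 1: the factor has length r and is ⊂ c^r, so it cannot contain two
--     adjacent distinct letters.  Every window of length r starting at a
--     position ≥ 2 contains "ab" or "ba", so the factor starts at 1; there it
--     is ◇^{k+1} a ⊂ a^r.

open import Defs
open import Data.Nat using (ℕ; _≤_; zero; suc; pred; _+_; _*_; s≤s; z≤n)
open import Data.Nat.Properties
  using ( *-identityʳ; *-monoʳ-<; +-cancelʳ-≤; m≤n⇒m⊓n≡m; m+n≤o⇒m≤o∸n; +-comm
        ; m+n≤o⇒n≤o; n≤0⇒n≡0; ≤-pred; ≤-reflexive; <⇒≱; m≤m+n; m≢1+m+n; +-suc)
open import Data.Nat.Tactic.RingSolver using (solve-∀)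
open import Data.List using (List; []; _∷_; _++_; map; replicate; take; drop; length)
open import Data.List.Properties using (length-take; length-drop; length-++; length-replicate; length-map; take-all)
open import Data.List.Relation.Binary.Pointwise using ([]; _∷_; Pointwise-length)
open import Data.Maybe using (just)
open import Data.Sum using (_⊎_; inj₁; inj₂)
open import Data.Product using (∃₂; _×_; _,_)
open import Data.Empty using (⊥; ⊥-elim)
open import Relation.Binary.PropositionalEquality
  using (_≡_; _≢_; refl; sym; trans; cong; cong₂; subst; module ≡-Reasoning)

flip : Letter → Letter
flip a = b
flip b = a

flipN : ℕ → Letter → Letter
flipN zero    c = c
flipN (suc n) c = flipN n (flip c)

flip-involutive : ∀ c → flip (flip c) ≡ c
flip-involutive a = refl
flip-involutive b = refl

flip-flipN : ∀ n c → flip (flipN n c) ≡ flipN n (flip c)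
flip-flipN zero    c = refl
flip-flipN (suc n) c = flip-flipN n (flip c)

-- Flipping n times is an involution; it lets us pick the first letter of an
-- alternating word so that a prescribed letter appears after n steps.
flipN-involutive : ∀ n c → flipN n (flipN n c) ≡ c
flipN-involutive zero    c = refl
flipN-involutive (suc n) c = begin
  flipN n (flip (flipN n (flip c)))   ≡⟨ cong (flipN n) (flip-flipN n (flip c)) ⟩
  flipN n (flipN n (flip (flip c)))   ≡⟨ cong (λ d → flipN n (flipN n d)) (flip-involutive c) ⟩
  flipN n (flipN n c)                 ≡⟨ flipN-involutive n c ⟩
  c                                   ∎
  where open ≡-Reasoning

alt : Letter → ℕ → FullWord
alt c zero    = []
alt c (suc n) = c ∷ alt (flip c) n

alt-length : ∀ c n → length (alt c n) ≡ n
alt-length c zero    = refl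
alt-length c (suc n) = cong suc (alt-length (flip c) n)

holes-++-⊂-alt : ∀ n m c (s : PartialWord) →
  s ⊂ map just (alt (flipN n c) m) → (holes n ++ s) ⊂ map just (alt c (n + m))
holes-++-⊂-alt zero    m c s s⊂ = s⊂
holes-++-⊂-alt (suc n) m c s s⊂ = hole⊑ ∷ holes-++-⊂-alt n m (flip c) s s⊂

alt-power : ∀ c r → (c ∷ flip c ∷ []) ^^ r ≡ alt c (r * 2)
alt-power c zero    = refl
alt-power c (suc r) = cong (λ z → c ∷ flip c ∷ z)
  (trans (alt-power c r) (cong (λ d → alt d (r * 2)) (sym (flip-involutive c))))

unary-power : ∀ c r → (c ∷ []) ^^ r ≡ replicate r c
unary-power c zero    = refl
unary-power c (suc r) = cong (c ∷_) (unary-power c r)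

holes-⊂ : ∀ n (v : FullWord) → length v ≡ n → holes n ⊂ map just v
holes-⊂ zero    []      _  = []
holes-⊂ (suc n) (_ ∷ v) eq = hole⊑ ∷ holes-⊂ n v (cong pred eq)

power-length : ∀ (x : FullWord) r → length (x ^^ r) ≡ r * length x
power-length x zero    = refl
power-length x (suc r) = trans (length-++ x) (cong (length x +_) (power-length x r))

⊂-power-length : ∀ {u : PartialWord} (x : FullWord) r → u ⊂ map just (x ^^ r) → length u ≡ r * length x
⊂-power-length {u} x r u⊂ = begin
  length u                    ≡⟨ Pointwise-length u⊂ ⟩
  length (map just (x ^^ r))  ≡⟨ length-map just (x ^^ r) ⟩
  length (x ^^ r)             ≡⟨ power-length x r ⟩
  r * length x                ∎
  where open ≡-Reasoning

factor-length : ∀ (w : PartialWord) j ℓ → j + ℓ ≤ length w → length (take ℓ (drop j w)) ≡ ℓ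
factor-length w j ℓ bound = trans (length-take ℓ (drop j w)) (m≤n⇒m⊓n≡m ℓ≤rest)
  where
  ℓ≤rest : ℓ ≤ length (drop j w)
  ℓ≤rest = subst (ℓ ≤_) (sym (length-drop j w))
             (m+n≤o⇒m≤o∸n ℓ (subst (_≤ length w) (+-comm j ℓ) bound))

-- StepWithin n u: among the first n symbols of u there are two adjacent,
-- distinct letters.  Such a window can never be a unary power.
data StepWithin : ℕ → PartialWord → Set where
  here  : ∀ {n x y s} → x ≢ y → StepWithin (suc (suc n)) (just x ∷ just y ∷ s)
  there : ∀ {n z u} → StepWithin n u → StepWithin (suc n) (z ∷ u)

StepWithin-weaken : ∀ {n u} → StepWithin n u → StepWithin (suc n) u
StepWithin-weaken (here x≢y) = here x≢y
StepWithin-weaken (there st) = there (StepWithin-weaken st)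

step-⊄-constant : ∀ {n u c} → StepWithin n u → take n u ⊂ map just (replicate n c) → ⊥
step-⊄-constant (here x≢y) (just⊑ ∷ just⊑ ∷ _) = x≢y refl
step-⊄-constant (there st) (_ ∷ u⊂)            = step-⊄-constant st u⊂

-- Facts about w = ◇^{k+1} a b a ◇^k, i.e. r = k + 2; its length 2r splits
-- as (k + 1) holes followed by the k + 3 symbols a b a ◇^k.
length-split : ∀ k → suc (suc k) * 2 ≡ suc k + suc (suc (suc k))
length-split = solve-∀

double : ∀ n → n * 2 ≡ n + n
double = solve-∀

wordW-length : ∀ k → length (wordW (suc (suc k))) ≡ suc (suc k) * 2
wordW-length k = begin
  length (holes (suc k) ++ just a ∷ just b ∷ just a ∷ holes k)
    ≡⟨ length-++ (holes (suc k)) ⟩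
  length (holes (suc k)) + suc (suc (suc (length (holes k))))
    ≡⟨ cong₂ (λ u v → u + suc (suc (suc v))) (length-replicate (suc k)) (length-replicate k) ⟩
  suc k + suc (suc (suc k))
    ≡⟨ length-split k ⟨
  suc (suc k) * 2
    ∎
  where
  open ≡-Reasoning

holes-then-a : ∀ k s → take (suc k) (holes k ++ just a ∷ s) ⊂ map just (replicate (suc k) a)
holes-then-a zero    s = just⊑ ∷ []
holes-then-a (suc k) s = hole⊑ ∷ holes-then-a k s

holes-then-step : ∀ n s → StepWithin (suc (suc n)) (holes n ++ just a ∷ just b ∷ s)
holes-then-step zero    s = here (λ ())
holes-then-step (suc n) s = there (holes-then-step n s)

late-window-step : ∀ k j s → j ≤ suc k →
  StepWithin (suc (suc k)) (drop (suc j) (holes (suc k) ++ just a ∷ just b ∷ just a ∷ s))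
late-window-step k       zero    s _             = holes-then-step k (just a ∷ s)
late-window-step zero    (suc j) s (s≤s z≤n)     = here (λ ())
late-window-step (suc k) (suc j) s (s≤s j≤1+k)   = StepWithin-weaken (late-window-step k j s j≤1+k)

module _ (k : ℕ) where
  private
    R : ℕ
    R = suc (suc k)

    w : PartialWord
    w = wordW R

  prefix-power : ValidOcc w 1 R × IsPower R (factor w 1 R)
  prefix-power =
    (s≤s z≤n , subst (R ≤_) (sym (trans (wordW-length k) (double R))) (m≤m+n R R)) ,
    (a ∷ []) , (λ ()) ,
    subst (λ v → factor w 1 R ⊂ map just v) (sym (unary-power a R))
      (holes-then-a (suc k) (just b ∷ just a ∷ holes k))

  -- The second power: w itself ⊂ (c (flip c))^r, where c is chosen so that
  -- the alternating word has the letter a at position r.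
  whole-power : ValidOcc w 1 (R * 2) × IsPower R (factor w 1 (R * 2))
  whole-power =
    (s≤s z≤n , ≤-reflexive (sym (wordW-length k))) ,
    (c ∷ flip c ∷ []) , (λ ()) ,
    subst (_⊂ map just ((c ∷ flip c ∷ []) ^^ R)) (sym (take-all (R * 2) w (≤-reflexive (wordW-length k))))
      (subst (λ v → w ⊂ map just v) (sym (alt-power c R)) w⊂alt)
    where
    c : Letter
    c = flipN (suc k) a

    body⊂ : (just a ∷ just b ∷ just a ∷ holes k) ⊂ map just (alt (flipN (suc k) c) (suc (suc (suc k))))
    body⊂ rewrite flipN-involutive (suc k) a = just⊑ ∷ just⊑ ∷ just⊑ ∷ holes-⊂ k (alt b k) (alt-length b k)

    w⊂alt : w ⊂ map just (alt c (R * 2))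
    w⊂alt = subst (λ n → w ⊂ map just (alt c n)) (sym (length-split k))
              (holes-++-⊂-alt (suc k) (suc (suc (suc k))) c _ body⊂)

  unary-power-at-start : ∀ j c → j + R ≤ R * 2 →
    factor w (suc j) R ⊂ map just (replicate R c) → j ≡ 0
  unary-power-at-start zero     c _     _  = refl
  unary-power-at-start (suc j) c bound f⊂ =
    ⊥-elim (step-⊄-constant (late-window-step k j (holes k) j≤1+k) f⊂)
    where
    j≤1+k : j ≤ suc k
    j≤1+k = ≤-pred (+-cancelʳ-≤ R (suc j) R (subst (suc j + R ≤_) (double R) bound))

  power-by-root : ∀ j ℓ → j + ℓ ≤ R * 2 → (x : FullWord) → x ≢ [] → ℓ ≡ R * length x →
    factor w (suc j) ℓ ⊂ map just (x ^^ R) → (suc j ≡ 1) × ((ℓ ≡ R) ⊎ (ℓ ≡ R * 2))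
  power-by-root j ℓ bound [] x≢[] _ _ = ⊥-elim (x≢[] refl)
  power-by-root j ℓ bound (c ∷ []) _ ℓ≡ f⊂ with trans ℓ≡ (*-identityʳ R)
  ... | refl = cong suc (unary-power-at-start j c bound (subst (λ v → factor w (suc j) R ⊂ map just v) (unary-power c R) f⊂)) , inj₁ refl
  power-by-root j ℓ bound (_ ∷ _ ∷ []) _ refl _ = cong suc (n≤0⇒n≡0 (+-cancelʳ-≤ (R * 2) j 0 bound)) , inj₂ refl
  power-by-root j ℓ bound (_ ∷ _ ∷ _ ∷ x) _ refl _ =
    ⊥-elim (<⇒≱ (*-monoʳ-< R (s≤s (s≤s (s≤s z≤n)))) (m+n≤o⇒n≤o j bound))

  only-two-powers : (i ℓ : ℕ) → ValidOcc w i ℓ → IsPower R (factor w i ℓ) →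
    (i ≡ 1) × ((ℓ ≡ R) ⊎ (ℓ ≡ R * 2))
  only-two-powers (suc j) ℓ (_ , bound) (x , x≢[] , f⊂) =
    power-by-root j ℓ (subst (j + ℓ ≤_) (wordW-length k) bound) x x≢[]
      (trans (sym (factor-length w j ℓ bound)) (⊂-power-length x R f⊂)) f⊂

r≢2r : ∀ r' → suc r' ≢ suc r' * 2
r≢2r r' eq = m≢1+m+n (suc r') (trans eq (trans (double (suc r')) (+-suc (suc r') r')))

proposition7 : (r : ℕ) → 2 ≤ r →
    ∃₂ λ (ℓ₁ ℓ₂ : ℕ) →
    (ℓ₁ ≢ ℓ₂)
    × (ValidOcc (wordW r) 1 ℓ₁ × IsPower r (factor (wordW r) 1 ℓ₁))
    × (ValidOcc (wordW r) 1 ℓ₂ × IsPower r (factor (wordW r) 1 ℓ₂))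
    × ((i ℓ : ℕ) → ValidOcc (wordW r) i ℓ → IsPower r (factor (wordW r) i ℓ) →
    (i ≡ 1) × ((ℓ ≡ ℓ₁) ⊎ (ℓ ≡ ℓ₂)))
proposition7 (suc (suc k)) (s≤s (s≤s z≤n)) =
  suc (suc k) , suc (suc k) * 2 , r≢2r (suc k) ,
  prefix-power k , whole-power k , only-two-powers k
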